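{- Let $t$ be the Thue–Morse word, the fixed point starting with $a$ of the morphism $a\mapsto abba$, $b\mapsto baab$, and let $N\ge 1$. If $PPL_t(4(N-1)+2)=\min(PPL_t(N-1),PPL_t(N))+2$, then $PPL_t(4N-2)>PPL_t(4N)$.
   Context: $PPL_t(n)$ is the minimal number of palindromes whose concatenation is the prefix of $t$ of length $n$, with $PPL_t(0)=0$. -}

module Defs where

open import Data.Nat using (ℕ; zero; suc; _<_; _≤_)
open import Data.List using (List; []; _∷_; concatMap; reverse; length; lookup; concat; take)
open import Data.List.Relation.Unary.All using (All)
open import Data.Product using (Σ; _×_; _,_)
open import Data.Maybe using (Maybe; just; nothing)
open import Relation.Binary.PropositionalEquality using (_≡_)

data Letter : Set where
  a b : Letter

μ : Letter → List Letter
μ a = a ∷ b ∷ b ∷ a ∷ []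
μ b = b ∷ a ∷ a ∷ b ∷ []

-- μ^k(a), a word of length 4^k; each is a prefix of the next.
μIter : ℕ → List Letter
μIter zero    = a ∷ []
μIter (suc k) = concatMap μ (μIter k)

_!!_ : List Letter → ℕ → Maybe Letter
[]       !! _       = nothing
(x ∷ xs) !! zero    = just x
(x ∷ xs) !! (suc n) = xs !! n

-- Thue–Morse word t (fixed point of μ starting with a), as a function ℕ → Letter:
-- t(n) is the n-th letter of μ^(n+1)(a), which has length 4^(n+1) > n.
t : ℕ → Letter
t n with μIter (suc n) !! n
... | just x  = x
... | nothing = a   -- unreachable

prefix : ℕ → List Letter
prefix zero    = []
prefix (suc n) = prefix n Data.List.++ (t n ∷ [])

Palindrome : List Letter → Set
Palindrome w = w ≡ reverse w

PalFact : List Letter → ℕ → Set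
PalFact w k = Σ (List (List Letter)) λ ps →
  All Palindrome ps × concat ps ≡ w × length ps ≡ k

-- PPL_t(n) = k : k is the minimal number of palindromes whose concatenation
-- is the prefix of t of length n (so PPL_t(0) = 0 via the empty factorization).
PPL≡ : ℕ → ℕ → Set
PPL≡ n k = PalFact (prefix n) k × (∀ m → PalFact (prefix n) m → k ≤ m)

module Submission where

-- Proof idea.  Write M for the Thue–Morse morphism μ extended to words and
-- P(n) for the prefix of t of length n.  Two inequalities about PPL suffice:
--
--   * PPL_t(4N) ≤ PPL_t(N): t is the fixed point of μ, so P(4N) = M(P(N)),
--     and M maps palindromes to palindromes (each μ(x) is a palindrome), so
--     applying M to an optimal factorisation of P(N) factorises P(4N);
--   * PPL_t(N) ≤ PPL_t(N-1) + 1: append the one-letter palindrome t(N-1).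
--
-- Hence PPL_t(4N) ≤ min(PPL_t(N-1), PPL_t(N)) + 1, which by hypothesis is
-- PPL_t(4N-2) - 1, since 4N-2 = 4(N-1)+2 and PPL_t is a function.

open import Defs
open import Data.Nat using (ℕ; zero; suc; _+_; _*_; _∸_; _<_; _≤_; _⊓_; z≤n; s≤s)
open import Data.Nat.Properties
open import Data.List using (List; []; _∷_; _++_; concatMap; reverse; length; concat; take; map)
open import Data.List.Properties
  using (concatMap-++; ++-assoc; ++-identityʳ; reverse-++; unfold-reverse; length-map; length-++; concat-++)
open import Data.List.Relation.Unary.All using (All; []; _∷_)
open import Data.List.Relation.Unary.All.Properties using (++⁺)
open import Data.Product using (Σ; _,_)
open import Data.Maybe using (just)
open import Relation.Binary.PropositionalEquality

module _ {A B : Set} (f : A → List B) where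

  concatMap-reverse : (∀ x → reverse (f x) ≡ f x) →
                      ∀ w → reverse (concatMap f w) ≡ concatMap f (reverse w)
  concatMap-reverse pal [] = refl
  concatMap-reverse pal (x ∷ w) = begin
      reverse (f x ++ concatMap f w)
    ≡⟨ reverse-++ (f x) (concatMap f w) ⟩
      reverse (concatMap f w) ++ reverse (f x)
    ≡⟨ cong₂ _++_ (concatMap-reverse pal w) (pal x) ⟩
      concatMap f (reverse w) ++ f x
    ≡⟨ cong (concatMap f (reverse w) ++_) (sym (++-identityʳ (f x))) ⟩
      concatMap f (reverse w) ++ concatMap f (x ∷ [])
    ≡⟨ sym (concatMap-++ f (reverse w) (x ∷ [])) ⟩
      concatMap f (reverse w ++ x ∷ [])
    ≡⟨ cong (concatMap f) (sym (unfold-reverse x w)) ⟩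
      concatMap f (reverse (x ∷ w))
    ∎ where open ≡-Reasoning

  concatMap-concat : ∀ ws → concatMap f (concat ws) ≡ concat (map (concatMap f) ws)
  concatMap-concat [] = refl
  concatMap-concat (w ∷ ws) =
    trans (concatMap-++ f w (concat ws)) (cong (concatMap f w ++_) (concatMap-concat ws))

M : List Letter → List Letter
M = concatMap μ

M-palindrome : ∀ w → Palindrome w → Palindrome (M w)
M-palindrome w w-pal = trans (cong M w-pal) (sym (concatMap-reverse μ μ-palindrome w))
  where
  μ-palindrome : ∀ x → reverse (μ x) ≡ μ x
  μ-palindrome a = refl
  μ-palindrome b = refl

length-M : ∀ w → length (M w) ≡ 4 * length w
length-M [] = refl
length-M (x ∷ w) = begin
    length (μ x ++ M w)          ≡⟨ length-++ (μ x) ⟩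
    length (μ x) + length (M w)  ≡⟨ cong₂ _+_ (length-μ x) (length-M w) ⟩
    4 + 4 * length w             ≡⟨ sym (*-suc 4 (length w)) ⟩
    4 * suc (length w)           ∎
  where
  open ≡-Reasoning
  length-μ : ∀ x → length (μ x) ≡ 4
  length-μ a = refl
  length-μ b = refl

take-M : ∀ n w → take (4 * n) (M w) ≡ M (take n w)
take-M zero w = refl
take-M (suc n) [] = refl
take-M (suc n) (x ∷ w) = trans (cong (λ m → take m (M (x ∷ w))) (*-suc 4 n)) (take-μ x)
  where
  take-μ : ∀ x → take (4 + 4 * n) (M (x ∷ w)) ≡ M (take (suc n) (x ∷ w))
  take-μ a = cong (λ z → a ∷ b ∷ b ∷ a ∷ z) (take-M n w)
  take-μ b = cong (λ z → b ∷ a ∷ a ∷ b ∷ z) (take-M n w)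

lookup-++ : ∀ (L R : List Letter) n → n < length L → (L ++ R) !! n ≡ L !! n
lookup-++ (x ∷ L) R zero    _        = refl
lookup-++ (x ∷ L) R (suc n) (s≤s lt) = lookup-++ L R n lt

lookup-defined : ∀ (L : List Letter) n → n < length L → Σ Letter λ x → L !! n ≡ just x
lookup-defined (x ∷ L) zero    _        = x , refl
lookup-defined (x ∷ L) (suc n) (s≤s lt) = lookup-defined L n lt

take-snoc : ∀ (L : List Letter) n x → L !! n ≡ just x → take (suc n) L ≡ take n L ++ x ∷ []
take-snoc (y ∷ L) zero    x refl  = refl
take-snoc (y ∷ L) (suc n) x found = cong (y ∷_) (take-snoc L n x found)

-- μ^k(a) is a prefix of μ^(k+1)(a): true for k = 0 as μ(a) = a·bba, and
-- preserved by applying M.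
μIter-step : ∀ k → Σ (List Letter) λ R → μIter (suc k) ≡ μIter k ++ R
μIter-step zero = b ∷ b ∷ a ∷ [] , refl
μIter-step (suc k) with μIter-step k
... | R , extends = M R , trans (cong M extends) (concatMap-++ μ (μIter k) R)

μIter-extend : ∀ j k → Σ (List Letter) λ R → μIter (j + k) ≡ μIter k ++ R
μIter-extend zero    k = [] , sym (++-identityʳ (μIter k))
μIter-extend (suc j) k with μIter-extend j k | μIter-step (j + k)
... | R , extends | R′ , step =
  R ++ R′ , trans step (trans (cong (_++ R′) extends) (++-assoc (μIter k) R R′))

length-μIter : ∀ k → k < length (μIter k)
length-μIter zero    = s≤s z≤n
length-μIter (suc k) = begin-strict
    suc k                       ≤⟨ length-μIter k ⟩
    length (μIter k)            <⟨ grows (≤-trans (s≤s z≤n) (length-μIter k)) ⟩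
    4 * length (μIter k)        ≡⟨ sym (length-M (μIter k)) ⟩
    length (μIter (suc k))      ∎
  where
  open ≤-Reasoning
  grows : ∀ {L} → 0 < L → L < 4 * L
  grows {suc m} _ = subst (suc m <_) (*-comm (suc m) 4) (m<m*n (suc m) 4 (s≤s (s≤s z≤n)))

μIter-agree : ∀ k l n → n < length (μIter k) → n < length (μIter l) →
              μIter k !! n ≡ μIter l !! n
μIter-agree k l n in-k in-l with μIter-extend l k | μIter-extend k l
... | R , k-prefix | R′ , l-prefix = begin
    μIter k !! n              ≡⟨ sym (lookup-++ (μIter k) R n in-k) ⟩
    (μIter k ++ R) !! n       ≡⟨ cong (_!! n) (sym k-prefix) ⟩
    μIter (l + k) !! n        ≡⟨ cong (λ m → μIter m !! n) (+-comm l k) ⟩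
    μIter (k + l) !! n        ≡⟨ cong (_!! n) l-prefix ⟩
    (μIter l ++ R′) !! n      ≡⟨ lookup-++ (μIter l) R′ n in-l ⟩
    μIter l !! n              ∎
  where open ≡-Reasoning

t-defining : ∀ n x → μIter (suc n) !! n ≡ just x → t n ≡ x
t-defining n x found with μIter (suc n) !! n
t-defining n x refl | just .x = refl

μIter-t : ∀ k n → n < length (μIter k) → μIter k !! n ≡ just (t n)
μIter-t k n in-k with lookup-defined (μIter k) n in-k
... | x , found = trans found (cong just (sym (t-defining n x found′)))
  where
  found′ : μIter (suc n) !! n ≡ just x
  found′ = trans (μIter-agree (suc n) k n (≤-trans (n≤1+n (suc n)) (length-μIter (suc n))) in-k) found

prefix-take : ∀ k n → n ≤ length (μIter k) → prefix n ≡ take n (μIter k)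
prefix-take k zero    _    = refl
prefix-take k (suc n) in-k =
  trans (cong (_++ t n ∷ []) (prefix-take k n (≤-trans (n≤1+n n) in-k)))
        (sym (take-snoc (μIter k) n (t n) (μIter-t k n in-k)))

-- t is a fixed point of M, in the form: the prefix of length 4N is M of the prefix of length N.
prefix-4* : ∀ N → prefix (4 * N) ≡ M (prefix N)
prefix-4* N = begin
    prefix (4 * N)              ≡⟨ prefix-take (suc N) (4 * N) in-range ⟩
    take (4 * N) (M (μIter N))  ≡⟨ take-M N (μIter N) ⟩
    M (take N (μIter N))        ≡⟨ cong M (sym (prefix-take N N (<⇒≤ (length-μIter N)))) ⟩
    M (prefix N)                ∎
  where
  open ≡-Reasoning
  in-range : 4 * N ≤ length (M (μIter N))
  in-range = ≤-trans (*-monoʳ-≤ 4 (<⇒≤ (length-μIter N))) (≤-reflexive (sym (length-M (μIter N))))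

PalFact-M : ∀ {w k} → PalFact w k → PalFact (M w) k
PalFact-M (ws , all-pal , concat-ws , length-ws) =
  map M ws , all-M all-pal ,
  trans (sym (concatMap-concat μ ws)) (cong M concat-ws) ,
  trans (length-map M ws) length-ws
  where
  all-M : ∀ {vs} → All Palindrome vs → All Palindrome (map M vs)
  all-M []                = []
  all-M (_∷_ {x = v} p ps) = M-palindrome v p ∷ all-M ps

PalFact-snoc : ∀ {w k} x → PalFact w k → PalFact (w ++ x ∷ []) (suc k)
PalFact-snoc x (ws , all-pal , concat-ws , length-ws) =
  ws ++ (x ∷ []) ∷ [] , ++⁺ all-pal (refl ∷ []) ,
  trans (sym (concat-++ ws ((x ∷ []) ∷ []))) (cong (_++ x ∷ []) concat-ws) ,
  trans (length-++ ws) (trans (+-comm (length ws) 1) (cong suc length-ws))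

PPL-unique : ∀ n {k l} → PPL≡ n k → PPL≡ n l → k ≡ l
PPL-unique n (fact-k , min-k) (fact-l , min-l) = ≤-antisym (min-k _ fact-l) (min-l _ fact-k)

PPL-4*-≤ : ∀ N {r u} → PPL≡ N r → PPL≡ (4 * N) u → u ≤ r
PPL-4*-≤ N (fact-r , _) (_ , min-u) =
  min-u _ (subst (λ w → PalFact w _) (sym (prefix-4* N)) (PalFact-M fact-r))

PPL-suc-≤ : ∀ n {q r} → PPL≡ n q → PPL≡ (suc n) r → r ≤ suc q
PPL-suc-≤ n (fact-q , _) (_ , min-r) = min-r _ (PalFact-snoc (t n) fact-q)

proposition8 : (N : ℕ) → 1 ≤ N →
    ∀ p q r s u → PPL≡ (4 * (N ∸ 1) + 2) p → PPL≡ (N ∸ 1) q → PPL≡ N r →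
    PPL≡ (4 * N ∸ 2) s → PPL≡ (4 * N) u →
    p ≡ (q ⊓ r) + 2 → u < s
proposition8 (suc K) _ p q r s u PPL-p PPL-q PPL-r PPL-s PPL-u p≡ = begin-strict
    u                ≤⟨ ⊓-glb (≤-trans u≤r (PPL-suc-≤ K PPL-q PPL-r)) (≤-trans u≤r (n≤1+n r)) ⟩
    suc (q ⊓ r)      <⟨ n<1+n (suc (q ⊓ r)) ⟩
    2 + q ⊓ r        ≡⟨ +-comm 2 (q ⊓ r) ⟩
    q ⊓ r + 2        ≡⟨ sym p≡ ⟩
    p                ≡⟨ PPL-unique (4 * K + 2) PPL-p (subst (λ m → PPL≡ m s) index PPL-s) ⟩
    s                ∎
  where
  open ≤-Reasoning
  index : 4 * suc K ∸ 2 ≡ 4 * K + 2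
  index = trans (cong (_∸ 2) (*-suc 4 K)) (+-comm 2 (4 * K))
  u≤r : u ≤ r
  u≤r = PPL-4*-≤ (suc K) PPL-r PPL-u
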